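{- Let $(j_n)_{n\ge 0}$ be defined by $j_0=0$, $j_{2k}=j_k$ and $j_{2k+1}=(-1)^k$ for all $k\ge 0$, and let $s_n=1+\sum_{0\le k\le n} j_k$. Define $a_0=0$, and let $(a_n)_{n\ge 1}$ be the increasing sequence of positive integers whose odd part is of the form $4k+1$. Then $a_n+s_{a_n}=2n+1$ for all $n\ge 0$.
   Context: The odd part of a positive integer $m$ is the odd integer $m/2^{v}$ where $2^v$ is the largest power of $2$ dividing $m$. -}

module Defs where

open import Data.Nat using (ℕ; zero; suc; _+_; _*_; _%_; _/_; _<_; _≤_)
open import Data.Integer as ℤ using (ℤ; +_; -_)
open import Data.List using (List; foldr; map; upTo)
open import Data.Product using (∃-syntax; _×_)
open import Relation.Binary.PropositionalEquality using (_≡_)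

neg1^ : ℕ → ℤ
neg1^ k with k % 2
... | zero = + 1
... | suc _ = - (+ 1)

-- j with fuel; the fuel n is always enough for argument n (halving).
-- j 0 = 0, j (2k) = j k, j (2k+1) = (-1)^k.
jF : ℕ → ℕ → ℤ
jF zero _ = + 0
jF (suc f) zero = + 0
jF (suc f) (suc m) with (suc m) % 2
... | zero = jF f (suc m / 2)
... | suc _ = neg1^ (suc m / 2)

j : ℕ → ℤ
j n = jF n n

s : ℕ → ℤ
s n = + 1 ℤ.+ foldr ℤ._+_ (+ 0) (map j (upTo (suc n)))

-- odd part of m (m / 2^v, 2^v the largest power of 2 dividing m), with fuel m;
-- oddPart 0 = 0 (irrelevant: only positive m are considered).
oddPartF : ℕ → ℕ → ℕ
oddPartF zero m = m
oddPartF (suc f) zero = zero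
oddPartF (suc f) (suc m) with (suc m) % 2
... | zero = oddPartF f (suc m / 2)
... | suc _ = suc m

oddPart : ℕ → ℕ
oddPart m = oddPartF m m

OddPart1mod4 : ℕ → Set
OddPart1mod4 m = ∃[ k ] oddPart m ≡ 4 * k + 1

{-# OPTIONS --safe #-}
-- Write oddPart m = 1 + 2p. Halving an even m changes neither its odd part nor j m, and for odd m
-- one has j m = (-1)^p; hence j m = 1 exactly when the odd part of m is 4k+1, and j m = -1
-- otherwise. So t m = m + s m grows by 1 + j m, i.e. by 2 at the terms of (a n) and by 0 in
-- between, and t (a 0) = t 0 = 1.
module Submission where

open import Defs
open import Data.Nat using (ℕ; zero; suc; _+_; _*_; _<_; _≤_; _%_; _/_; s≤s; z≤n)
import Data.Nat.Properties as ℕP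
open import Data.Nat.DivMod using (m≡m%n+[m/n]*n; m*n%n≡0; m%n<n; m/n<m; m≥n⇒m/n>0)
import Data.Nat.Tactic.RingSolver as ℕ-Solver
open import Data.Integer as ℤ using (ℤ; +_; -_)
import Data.Integer.Properties as ℤP
import Data.Integer.Tactic.RingSolver as ℤ-Solver
open import Data.List using (List; []; _∷_; _∷ʳ_; foldr; map; upTo)
open import Data.List.Properties using (upTo-∷ʳ)
open import Data.Product using (∃-syntax; _×_; _,_)
open import Data.Sum using (inj₁; inj₂)
open import Data.Empty using (⊥; ⊥-elim)
open import Relation.Nullary using (¬_)
open import Relation.Binary.PropositionalEquality
open ≡-Reasoning

m%2≡0⇒m≡2[m/2] : ∀ m → m % 2 ≡ 0 → m ≡ 2 * (m / 2)
m%2≡0⇒m≡2[m/2] m m%2≡0 = begin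
  m                 ≡⟨ m≡m%n+[m/n]*n m 2 ⟩
  m % 2 + m / 2 * 2 ≡⟨ cong₂ _+_ m%2≡0 (ℕP.*-comm (m / 2) 2) ⟩
  2 * (m / 2)       ∎

m%2≡1+r⇒m≡1+2[m/2] : ∀ m {r} → m % 2 ≡ suc r → m ≡ 1 + 2 * (m / 2)
m%2≡1+r⇒m≡1+2[m/2] m {r} m%2≡1+r = begin
  m                 ≡⟨ m≡m%n+[m/n]*n m 2 ⟩
  m % 2 + m / 2 * 2 ≡⟨ cong₂ _+_ (trans m%2≡1+r (cong suc r≡0)) (ℕP.*-comm (m / 2) 2) ⟩
  1 + 2 * (m / 2)   ∎
  where
  r≡0 : r ≡ 0
  r≡0 = ℕP.n≤0⇒n≡0 (ℕP.≤-pred (ℕP.≤-pred (subst (_< 2) m%2≡1+r (m%n<n m 2))))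

4k+1≡1+2[2k] : ∀ k → 4 * k + 1 ≡ 1 + 2 * (2 * k)
4k+1≡1+2[2k] = ℕ-Solver.solve-∀

2n+1+2≡2[1+n]+1 : ∀ n → 2 * n + 1 + 2 ≡ 2 * suc n + 1
2n+1+2≡2[1+n]+1 = ℕ-Solver.solve-∀

1+2p≡4k+1⇒p%2≡0 : ∀ p k → 1 + 2 * p ≡ 4 * k + 1 → p % 2 ≡ 0
1+2p≡4k+1⇒p%2≡0 p k eq = begin
  p % 2       ≡⟨ cong (_% 2) p≡2k ⟩
  (2 * k) % 2 ≡⟨ cong (_% 2) (ℕP.*-comm 2 k) ⟩
  (k * 2) % 2 ≡⟨ m*n%n≡0 k 2 ⟩
  0           ∎
  where
  p≡2k : p ≡ 2 * k
  p≡2k = ℕP.*-cancelˡ-≡ p (2 * k) 2 (ℕP.suc-injective (trans eq (4k+1≡1+2[2k] k)))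

p%2≡0⇒1+2p≡4[p/2]+1 : ∀ p → p % 2 ≡ 0 → 1 + 2 * p ≡ 4 * (p / 2) + 1
p%2≡0⇒1+2p≡4[p/2]+1 p p%2≡0 =
  trans (cong (λ q → 1 + 2 * q) (m%2≡0⇒m≡2[m/2] p p%2≡0)) (sym (4k+1≡1+2[2k] (p / 2)))

neg1^-even : ∀ p → p % 2 ≡ 0 → neg1^ p ≡ + 1
neg1^-even p p%2≡0 rewrite p%2≡0 = refl

neg1^-odd : ∀ p → ¬ p % 2 ≡ 0 → neg1^ p ≡ - (+ 1)
neg1^-odd p p%2≢0 with p % 2
... | zero  = ⊥-elim (p%2≢0 refl)
... | suc _ = refl

-- jF and oddPartF halve even arguments in lockstep; m ≤ f makes the fuel suffice.
jF-oddPartF : ∀ f m → 1 ≤ m → m ≤ f →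
              ∃[ p ] oddPartF f m ≡ 1 + 2 * p × jF f m ≡ neg1^ p
jF-oddPartF f       zero             ()
jF-oddPartF zero    (suc _)          _ ()
jF-oddPartF (suc f) (suc zero)       _ _ = 0 , refl , refl
jF-oddPartF (suc f) m@(suc (suc _))  _ (s≤s m≤1+f) with m % 2 in m%2
... | zero  = jF-oddPartF f (m / 2) (m≥n⇒m/n>0 {m} (s≤s (s≤s z≤n)))
                (ℕP.≤-trans (ℕP.≤-pred (m/n<m m 2 (s≤s (s≤s z≤n)))) m≤1+f)
... | suc _ = m / 2 , m%2≡1+r⇒m≡1+2[m/2] m m%2 , refl

j-oddPart1mod4 : ∀ m → 1 ≤ m → OddPart1mod4 m → j m ≡ + 1
j-oddPart1mod4 m 1≤m (k , oddPart≡4k+1) with jF-oddPartF m m 1≤m ℕP.≤-refl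
... | p , oddPart≡1+2p , j≡neg1^p =
  trans j≡neg1^p (neg1^-even p (1+2p≡4k+1⇒p%2≡0 p k (trans (sym oddPart≡1+2p) oddPart≡4k+1)))

j-¬oddPart1mod4 : ∀ m → 1 ≤ m → ¬ OddPart1mod4 m → j m ≡ - (+ 1)
j-¬oddPart1mod4 m 1≤m ¬good with jF-oddPartF m m 1≤m ℕP.≤-refl
... | p , oddPart≡1+2p , j≡neg1^p = trans j≡neg1^p (neg1^-odd p p%2≢0)
  where
  p%2≢0 : ¬ p % 2 ≡ 0
  p%2≢0 p%2≡0 = ¬good (p / 2 , trans oddPart≡1+2p (p%2≡0⇒1+2p≡4[p/2]+1 p p%2≡0))

Σj : List ℕ → ℤ
Σj xs = foldr ℤ._+_ (+ 0) (map j xs)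

Σj-∷ʳ : ∀ xs y → Σj (xs ∷ʳ y) ≡ Σj xs ℤ.+ j y
Σj-∷ʳ []       y = trans (ℤP.+-identityʳ (j y)) (sym (ℤP.+-identityˡ (j y)))
Σj-∷ʳ (x ∷ xs) y = trans (cong (ℤ._+_ (j x)) (Σj-∷ʳ xs y)) (sym (ℤP.+-assoc (j x) (Σj xs) (j y)))

s-suc : ∀ n → s (suc n) ≡ s n ℤ.+ j (suc n)
s-suc n = begin
  + 1 ℤ.+ Σj (upTo (suc (suc n)))           ≡⟨ cong (λ xs → + 1 ℤ.+ Σj xs) (sym (upTo-∷ʳ (suc n))) ⟩
  + 1 ℤ.+ Σj (upTo (suc n) ∷ʳ suc n)        ≡⟨ cong (ℤ._+_ (+ 1)) (Σj-∷ʳ (upTo (suc n)) (suc n)) ⟩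
  + 1 ℤ.+ (Σj (upTo (suc n)) ℤ.+ j (suc n)) ≡⟨ ℤP.+-assoc (+ 1) (Σj (upTo (suc n))) (j (suc n)) ⟨
  s n ℤ.+ j (suc n)                         ∎

t : ℕ → ℤ
t n = + n ℤ.+ s n

t-suc : ∀ n → t (suc n) ≡ t n ℤ.+ (+ 1 ℤ.+ j (suc n))
t-suc n = trans (cong (ℤ._+_ (+ suc n)) (s-suc n)) (regroup (+ n) (s n) (j (suc n)))
  where
  regroup : ∀ x y z → (+ 1 ℤ.+ x) ℤ.+ (y ℤ.+ z) ≡ (x ℤ.+ y) ℤ.+ (+ 1 ℤ.+ z)
  regroup = ℤ-Solver.solve-∀

t-suc-oddPart1mod4 : ∀ n → OddPart1mod4 (suc n) → t (suc n) ≡ t n ℤ.+ + 2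
t-suc-oddPart1mod4 n good =
  trans (t-suc n) (cong (λ z → t n ℤ.+ (+ 1 ℤ.+ z)) (j-oddPart1mod4 (suc n) (s≤s z≤n) good))

t-suc-¬oddPart1mod4 : ∀ n → ¬ OddPart1mod4 (suc n) → t (suc n) ≡ t n
t-suc-¬oddPart1mod4 n ¬good =
  trans (t-suc n) (trans (cong (λ z → t n ℤ.+ (+ 1 ℤ.+ z)) (j-¬oddPart1mod4 (suc n) (s≤s z≤n) ¬good))
                         (ℤP.+-identityʳ (t n)))

t-constant : ∀ {x y} → x ≤ y → (∀ m → x < m → m ≤ y → ¬ OddPart1mod4 m) → t y ≡ t x
t-constant {y = zero}  z≤n   _    = refl
t-constant {x} {suc y} x≤1+y none with ℕP.m≤n⇒m<n∨m≡n x≤1+y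
... | inj₂ refl       = refl
... | inj₁ (s≤s x≤y) = begin
  t (suc y) ≡⟨ t-suc-¬oddPart1mod4 y (none (suc y) (s≤s x≤y) ℕP.≤-refl) ⟩
  t y       ≡⟨ t-constant x≤y (λ m x<m m≤y → none m x<m (ℕP.m≤n⇒m≤1+n m≤y)) ⟩
  t x       ∎

t-jump : ∀ {x y} → x < y → (∀ m → x < m → m < y → ¬ OddPart1mod4 m) → OddPart1mod4 y →
         t y ≡ t x ℤ.+ + 2
t-jump {x} {suc y} (s≤s x≤y) none good = begin
  t (suc y)     ≡⟨ t-suc-oddPart1mod4 y good ⟩
  t y ℤ.+ + 2   ≡⟨ cong (λ z → z ℤ.+ + 2) (t-constant x≤y (λ m x<m m≤y → none m x<m (s≤s m≤y))) ⟩
  t x ℤ.+ + 2   ∎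

module _ {f : ℕ → ℕ} (f-inc : ∀ n → f n < f (suc n)) where

  increasing⇒monotone : ∀ {i n} → i ≤ n → f i ≤ f n
  increasing⇒monotone {n = zero}  z≤n = ℕP.≤-refl
  increasing⇒monotone {n = suc n} i≤1+n with ℕP.m≤n⇒m<n∨m≡n i≤1+n
  ... | inj₁ (s≤s i≤n) = ℕP.≤-trans (increasing⇒monotone i≤n) (ℕP.<⇒≤ (f-inc n))
  ... | inj₂ refl      = ℕP.≤-refl

  increasing⇒no-value-between : ∀ {n i} → f n < f i → f i < f (suc n) → ⊥
  increasing⇒no-value-between {n} {i} fn<fi fi<f1+n = ℕP.<⇒≱ fi<f1+n (increasing⇒monotone n<i)
    where
    n<i : n < i
    n<i = ℕP.≰⇒> (λ i≤n → ℕP.<⇒≱ fn<fi (increasing⇒monotone i≤n))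

theorem6 : (a : ℕ → ℕ)
    → a 0 ≡ 0
    → (∀ n → a n < a (suc n))
    → (∀ n → OddPart1mod4 (a (suc n)))
    → (∀ m → 1 ≤ m → OddPart1mod4 m → ∃[ n ] a n ≡ m)
    → ∀ n → + (a n) ℤ.+ s (a n) ≡ + (2 * n + 1)
theorem6 a a0 inc good enum = t-a
  where
  none-between : ∀ n m → a n < m → m < a (suc n) → ¬ OddPart1mod4 m
  none-between n m an<m m<a1+n goodm with enum m (ℕP.≤-trans (s≤s z≤n) an<m) goodm
  ... | i , refl = increasing⇒no-value-between inc an<m m<a1+n

  t-a : ∀ n → t (a n) ≡ + (2 * n + 1)
  t-a zero    rewrite a0 = refl
  t-a (suc n) = begin
    t (a (suc n))     ≡⟨ t-jump (inc n) (none-between n) (good n) ⟩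
    t (a n) ℤ.+ + 2   ≡⟨ cong (λ z → z ℤ.+ + 2) (t-a n) ⟩
    + (2 * n + 1 + 2) ≡⟨ cong +_ (2n+1+2≡2[1+n]+1 n) ⟩
    + (2 * suc n + 1) ∎
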